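{- Let $r_1,r_2,y\in\mathbb{N}$ with $r_2>2$ satisfy $\phi(y)=\phi(R(r_1,r_2))$, $|W(y)|=4$, $v_2(y)=1$, $v_3(y)\ge1$ and $v_5(y)=0$. Then $y\le R(r_1,r_2)$.
   Context: $\phi$ is Euler's totient function; $R(r_1,r_2)=2\cdot3^{r_1}\cdot5^{r_2}$; $W(y)$ is the set of prime divisors of $y$; for a prime $p$, $v_p(y)$ is the largest $r\ge0$ with $p^r\mid y$. -}

module Defs where

open import Data.Nat using (ℕ; zero; suc; _+_; _*_; _^_)
open import Data.Nat.GCD using (gcd)
open import Data.Nat.Primality using (prime?)
open import Data.Nat.Divisibility using (_∣?_)
open import Data.List using (List; length; filter; upTo; map)
open import Relation.Nullary.Decidable using (_×-dec_)
open import Data.Nat.Properties using (_≟_)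

-- Euler's totient: φ(n) = #{ k ∈ {1,…,n} : gcd(k,n) = 1 }  (so φ 0 = 0)
φ : ℕ → ℕ
φ n = length (filter (λ k → gcd k n ≟ 1) (map suc (upTo n)))

R : ℕ → ℕ → ℕ
R r₁ r₂ = 2 * 3 ^ r₁ * 5 ^ r₂

-- W(y) as a list: the primes p ≤ y with p ∣ y (for y ≥ 1 these are exactly the prime divisors)
W : ℕ → List ℕ
W y = filter (λ p → prime? p ×-dec (p ∣? y)) (upTo (suc y))

∣W∣ : ℕ → ℕ
∣W∣ y = length (W y)

{-# OPTIONS --safe #-}
-- For a nonzero n with distinct prime divisors P, φ n * ∏_{p ∈ P} p = n * ∏_{p ∈ P} (p - 1), so
-- only the primes dividing y and R matter. The hypotheses make those of y exactly 2, 3, p, q with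
-- 3 < p < q and p ≠ 5, whence 6pq φ(y) = 2(p - 1)(q - 1) y. If 3 ∣ R, then 4 R = 15 φ(R), and since
-- φ(y) = φ(R) the claim y ≤ R reduces to 4pq ≤ 5(p - 1)(q - 1). This holds when p ≥ 11; for p = 7
-- it needs q ≥ 26, which follows because r₂ > 2 gives 25 ∣ φ(R) = φ(y), forcing 25 ∣ q - 1.
-- If 3 ∤ R, then φ(R) = 4 * 5^(r₂ - 1) is not divisible by 8, but φ(y) is, as p - 1, q - 1 and y are even.
module Submission where

open import Algebra.Properties.CommutativeSemigroup using (interchange)
open import Data.Bool.Base using (Bool; true; false; _∧_; not)
open import Data.Bool.Properties using (∧-zeroʳ; ∧-identityʳ)
open import Data.List.Base using ([]; _∷_; applyUpTo; filter; length; map; upTo)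
open import Data.List.Membership.Propositional using (_∈_)
open import Data.List.Membership.Propositional.Properties using (∈-filter⁺; ∈-filter⁻; ∈-upTo⁺; ∉[])
open import Data.List.Relation.Unary.All as All using (All; []; _∷_)
open import Data.List.Relation.Unary.AllPairs as AllPairs using (AllPairs; []; _∷_)
import Data.List.Relation.Unary.AllPairs.Properties as AllPairsₚ
open import Data.List.Relation.Unary.Any using (here; there)
open import Data.List.Relation.Unary.Unique.Propositional using (Unique)
open import Data.Nat.Base
open import Data.Nat.Coprimality as Coprimality
  using (Coprime; coprime?; coprime⇒gcd≡1; gcd≡1⇒coprime; coprime-divisor; coprime-+)
open import Data.Nat.Divisibility
open import Data.Nat.GCD using (gcd)
open import Data.Nat.Induction using (<-rec)
open import Data.Nat.ListAction using (product)
open import Data.Nat.Primality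
open import Data.Nat.Primality.Factorisation using (factorise)
open import Data.Nat.Properties
open import Data.Nat.Tactic.RingSolver using (solve-∀)
open import Data.Product.Base using (_×_; _,_; proj₁; proj₂; ∃₂)
open import Data.Sum.Base using (_⊎_; inj₁; inj₂; [_,_]′)
open import Function.Base using (_∘_)
open import Function.Bundles using (_⇔_; mk⇔; module Equivalence)
open import Relation.Binary.PropositionalEquality
open import Relation.Nullary.Decidable
  using (does; yes; no; _×-dec_; ¬?; does-⇔; dec-true; dec-false; from-yes; from-no)
open import Relation.Nullary.Negation using (¬_; contradiction)
open import Relation.Unary using (Decidable)

open import Defs

bit : Bool → ℕ
bit true = 1
bit false = 0

count : (ℕ → Bool) → ℕ → ℕ
count f zero = 0
count f (suc n) = bit (f 0) + count (f ∘ suc) n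

count-cong : ∀ {f g} n → (∀ k → f k ≡ g k) → count f n ≡ count g n
count-cong zero f≗g = refl
count-cong (suc n) f≗g = cong₂ _+_ (cong bit (f≗g 0)) (count-cong n (f≗g ∘ suc))

count-+ : ∀ f m n → count f (m + n) ≡ count f m + count (λ k → f (m + k)) n
count-+ f zero n = refl
count-+ f (suc m) n = trans (cong (bit (f 0) +_) (count-+ (f ∘ suc) m n)) (sym (+-assoc (bit (f 0)) _ _))

count-periodic : ∀ f n → (∀ k → f (n + k) ≡ f k) → ∀ c → count f (c * n) ≡ c * count f n
count-periodic f n f-periodic zero = refl
count-periodic f n f-periodic (suc c) = begin
  count f (n + c * n)                         ≡⟨ count-+ f n (c * n) ⟩
  count f n + count (λ k → f (n + k)) (c * n) ≡⟨ cong (count f n +_) (count-cong (c * n) f-periodic) ⟩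
  count f n + count f (c * n)                 ≡⟨ cong (count f n +_) (count-periodic f n f-periodic c) ⟩
  count f n + c * count f n                   ∎
  where open ≡-Reasoning

bit-split : ∀ a b → bit a ≡ bit (a ∧ b) + bit (a ∧ not b)
bit-split true true = refl
bit-split true false = refl
bit-split false b = refl

count-split : ∀ f g n → count f n ≡ count (λ k → f k ∧ g k) n + count (λ k → f k ∧ not (g k)) n
count-split f g zero = refl
count-split f g (suc n)
  rewrite count-split (f ∘ suc) (g ∘ suc) n | bit-split (f 0) (g 0) =
  interchange +-commutativeSemigroup (bit (f 0 ∧ g 0)) (bit (f 0 ∧ not (g 0))) _ _

count-last : ∀ f m → (∀ k → k < m → f k ≡ false) → count f (suc m) ≡ bit (f m)
count-last f zero _ = +-identityʳ (bit (f 0))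
count-last f (suc m) f<m≡false
  rewrite f<m≡false 0 z<s = count-last (f ∘ suc) m (λ k k<m → f<m≡false (suc k) (s<s k<m))

count-multiples : ∀ f p .{{_ : NonZero p}} n →
  count (λ k → f (suc k) ∧ does (p ∣? suc k)) (p * n) ≡ count (λ j → f (p * suc j)) n
count-multiples f p zero = cong (count _) (*-zeroʳ p)
count-multiples f p@(suc p-1) (suc n) = begin
  count g (p * suc n)                                      ≡⟨ cong (count g) (*-suc p n) ⟩
  count g (p + p * n)                                      ≡⟨ count-+ g p (p * n) ⟩
  count g p + count (λ k → g (p + k)) (p * n)
    ≡⟨ cong₂ _+_ first-block (count-cong (p * n) shift) ⟩
  bit (f (p * 1)) + count (λ k → f (p + suc k) ∧ does (p ∣? suc k)) (p * n)
    ≡⟨ cong (bit (f (p * 1)) +_) (count-multiples (f ∘ (p +_)) p n) ⟩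
  bit (f (p * 1)) + count (λ j → f (p + p * suc j)) n
    ≡⟨ cong (bit (f (p * 1)) +_) (count-cong n (cong f ∘ sym ∘ *-suc p ∘ suc)) ⟩
  count (λ j → f (p * suc j)) (suc n)                      ∎
  where
  open ≡-Reasoning
  g : ℕ → Bool
  g k = f (suc k) ∧ does (p ∣? suc k)
  first-block : count g p ≡ bit (f (p * 1))
  first-block = begin
    count g p                          ≡⟨ count-last g p-1 no-earlier-multiple ⟩
    bit (f p ∧ does (p ∣? p))          ≡⟨ cong (λ b → bit (f p ∧ b)) (dec-true (p ∣? p) ∣-refl) ⟩
    bit (f p ∧ true)                   ≡⟨ cong bit (trans (∧-identityʳ (f p)) (cong f (sym (*-identityʳ p)))) ⟩
    bit (f (p * 1))                    ∎
    where
    no-earlier-multiple : ∀ k → k < p-1 → g k ≡ false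
    no-earlier-multiple k k<p-1 =
      trans (cong (f (suc k) ∧_) (dec-false (p ∣? suc k) (>⇒∤ (s<s k<p-1)))) (∧-zeroʳ _)
  shift : ∀ k → g (p + k) ≡ f (p + suc k) ∧ does (p ∣? suc k)
  shift k = trans (cong (λ m → f m ∧ does (p ∣? m)) (sym (+-suc p k)))
                  (cong (f (p + suc k) ∧_) (does-⇔ p∣p+j⇔p∣j (p ∣? p + suc k) (p ∣? suc k)))
    where
    p∣p+j⇔p∣j : ∀ {j} → p ∣ p + j ⇔ p ∣ j
    p∣p+j⇔p∣j = mk⇔ (λ p∣p+j → ∣m+n∣m⇒∣n p∣p+j ∣-refl) (∣m∣n⇒∣m+n ∣-refl)

prime⇒1< : ∀ {p} → Prime p → 1 < p
prime⇒1< {p} pp = nonTrivial⇒n>1 p {{prime⇒nonTrivial pp}}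

prime∤prime : ∀ {r p} → Prime r → Prime p → r ≢ p → ¬ r ∣ p
prime∤prime pr pp r≢p r∣p with prime⇒irreducible pp r∣p
... | inj₁ refl = ¬prime[1] pr
... | inj₂ r≡p = r≢p r≡p

prime∤-* : ∀ {r a b} → Prime r → ¬ r ∣ a → ¬ r ∣ b → ¬ r ∣ a * b
prime∤-* {a = a} {b} pr r∤a r∤b r∣ab = [ r∤a , r∤b ]′ (euclidsLemma a b pr r∣ab)

prime∤-^ : ∀ {r a} → Prime r → ¬ r ∣ a → ∀ k → ¬ r ∣ a ^ k
prime∤-^ pr r∤a zero r∣1 = ¬prime[1] (subst Prime (∣1⇒≡1 r∣1) pr)
prime∤-^ pr r∤a (suc k) = prime∤-* pr r∤a (prime∤-^ pr r∤a k)

prime∣m*n∧∤m⇒∣n : ∀ {r m n} → Prime r → ¬ r ∣ m → r ∣ m * n → r ∣ n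
prime∣m*n∧∤m⇒∣n {m = m} {n} pr r∤m r∣mn =
  [ (λ r∣m → contradiction r∣m r∤m) , (λ r∣n → r∣n) ]′ (euclidsLemma m n pr r∣mn)

prime^∣m*n∧∤m⇒∣n : ∀ {p m n} → Prime p → ¬ p ∣ m → ∀ k → p ^ k ∣ m * n → p ^ k ∣ n
prime^∣m*n∧∤m⇒∣n {n = n} pp p∤m zero _ = 1∣ n
prime^∣m*n∧∤m⇒∣n {p} {m} pp p∤m (suc k) p^[1+k]∣mn
  with prime∣m*n∧∤m⇒∣n pp p∤m (∣-trans (m∣m*n (p ^ k)) p^[1+k]∣mn)
... | divides-refl c = subst (_∣ c * p) (*-comm (p ^ k) p) (*-monoˡ-∣ p p^k∣c)
  where
  p^k*p∣m*c*p : p ^ k * p ∣ m * c * p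
  p^k*p∣m*c*p = subst₂ _∣_ (*-comm p (p ^ k)) (sym (*-assoc m c p)) p^[1+k]∣mn
  p^k∣c : p ^ k ∣ c
  p^k∣c = prime^∣m*n∧∤m⇒∣n pp p∤m k (*-cancelʳ-∣ p {{prime⇒nonZero pp}} p^k*p∣m*c*p)

2∣n⊎2∣1+n : ∀ n → 2 ∣ n ⊎ 2 ∣ suc n
2∣n⊎2∣1+n zero = inj₁ (divides 0 refl)
2∣n⊎2∣1+n (suc n) = [ inj₂ ∘ ∣m∣n⇒∣m+n (∣-refl {2}) , inj₁ ]′ (2∣n⊎2∣1+n n)

2∤n⇒2∣n∸1 : ∀ {n} → ¬ 2 ∣ n → 2 ∣ n ∸ 1
2∤n⇒2∣n∸1 {zero} 2∤0 = contradiction (divides 0 refl) 2∤0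
2∤n⇒2∣n∸1 {suc n} 2∤1+n =
  [ (λ 2∣n → 2∣n) , (λ 2∣1+n → contradiction 2∣1+n 2∤1+n) ]′ (2∣n⊎2∣1+n n)

p∣n⇒n≡p^[1+k]*m : ∀ {p} → 1 < p → ∀ n .{{_ : NonZero n}} → p ∣ n →
  ∃₂ λ k m → n ≡ p ^ suc k * m × ¬ p ∣ m
p∣n⇒n≡p^[1+k]*m {p} 1<p = <-rec Goal split
  where
  Goal : ℕ → Set
  Goal n = .{{_ : NonZero n}} → p ∣ n → ∃₂ λ k m → n ≡ p ^ suc k * m × ¬ p ∣ m
  split : ∀ n → (∀ {n′} → n′ < n → Goal n′) → Goal n
  split .(q * p) rec (divides-refl q) with p ∣? q
  ... | no p∤q = 0 , q , trans (*-comm q p) (cong (_* q) (sym (*-identityʳ p))) , p∤q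
  ... | yes p∣q with rec (m<m*n q p {{m*n≢0⇒m≢0 q}} 1<p) {{m*n≢0⇒m≢0 q}} p∣q
  ...   | k , m , refl , p∤m = suc k , m , trans (*-comm (p ^ suc k * m) p) (sym (*-assoc p (p ^ suc k) m)) , p∤m

no-prime-divisor⇒≡1 : ∀ n .{{_ : NonZero n}} → (∀ {r} → Prime r → ¬ r ∣ n) → n ≡ 1
no-prime-divisor⇒≡1 n no-prime-divisor with factorise n
... | record { factors = [] ; isFactorisation = n≡1 } = n≡1
... | record { factors = r ∷ rs ; isFactorisation = refl ; factorsPrime = pr ∷ _ } =
  contradiction (m∣m*n (product rs)) (no-prime-divisor pr)

coprime-∣ˡ : ∀ {d m n} → d ∣ m → Coprime m n → Coprime d n
coprime-∣ˡ d∣m m⊥n (e∣d , e∣n) = m⊥n (∣-trans e∣d d∣m , e∣n)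

coprime-∣ʳ : ∀ {d m n} → d ∣ n → Coprime m n → Coprime m d
coprime-∣ʳ d∣n m⊥n (e∣m , e∣d) = m⊥n (e∣m , ∣-trans e∣d d∣n)

coprime-* : ∀ {k m n} → Coprime k m → Coprime k n → Coprime k (m * n)
coprime-* k⊥m k⊥n (d∣k , d∣m*n) = k⊥n (d∣k , coprime-divisor (coprime-∣ˡ d∣k k⊥m) d∣m*n)

prime∤⇒coprime : ∀ {p n} → Prime p → ¬ p ∣ n → Coprime p n
prime∤⇒coprime pp p∤n (d∣p , d∣n) with prime⇒irreducible pp d∣p
... | inj₁ d≡1 = d≡1
... | inj₂ refl = contradiction d∣n p∤n

coprime-+ˡ⇔ : ∀ {j n} → Coprime (n + j) n ⇔ Coprime j n
coprime-+ˡ⇔ {j} {n} = mk⇔ (λ c {_} (d∣j , d∣n) → c (∣m∣n⇒∣m+n d∣n d∣j , d∣n)) coprime-+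

coprime-*-∣⇔ : ∀ {k m n} → m ∣ n → Coprime k (m * n) ⇔ Coprime k n
coprime-*-∣⇔ {m = m} m∣n = mk⇔ (coprime-∣ʳ (n∣m*n m)) (λ k⊥n → coprime-* (coprime-∣ʳ m∣n k⊥n) k⊥n)

coprime-prime*⇔ : ∀ {p k n} → Prime p → Coprime k (p * n) ⇔ (Coprime k n × ¬ p ∣ k)
coprime-prime*⇔ {p} {k} {n} pp = mk⇔ to from
  where
  to : Coprime k (p * n) → Coprime k n × ¬ p ∣ k
  to k⊥pn = coprime-∣ʳ (n∣m*n p) k⊥pn , λ p∣k → ¬prime[1] (subst Prime (k⊥pn (p∣k , m∣m*n n)) pp)
  from : Coprime k n × ¬ p ∣ k → Coprime k (p * n)
  from (k⊥n , p∤k) = coprime-* (Coprimality.sym (prime∤⇒coprime pp p∤k)) k⊥n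

coprime-prime*ˡ⇔ : ∀ {p j n} → Prime p → ¬ p ∣ n → Coprime (p * j) n ⇔ Coprime j n
coprime-prime*ˡ⇔ {p} pp p∤n = mk⇔ (coprime-∣ˡ (n∣m*n p))
  (λ j⊥n → Coprimality.sym (coprime-* (Coprimality.sym (prime∤⇒coprime pp p∤n)) (Coprimality.sym j⊥n)))

length-filter-map-applyUpTo : ∀ {P : ℕ → Set} (P? : Decidable P) (g f : ℕ → ℕ) n →
  length (filter P? (map g (applyUpTo f n))) ≡ count (λ k → does (P? (g (f k)))) n
length-filter-map-applyUpTo P? g f zero = refl
length-filter-map-applyUpTo P? g f (suc n) with does (P? (g (f 0)))
... | true = cong suc (length-filter-map-applyUpTo P? g (f ∘ suc) n)
... | false = length-filter-map-applyUpTo P? g (f ∘ suc) n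

coprimeTo : ℕ → ℕ → Bool
coprimeTo n k = does (coprime? k n)

coprimeTo-cong : ∀ {j k m n} → Coprime j m ⇔ Coprime k n → coprimeTo m j ≡ coprimeTo n k
coprimeTo-cong {j} {k} {m} {n} j⊥m⇔k⊥n = does-⇔ j⊥m⇔k⊥n (coprime? j m) (coprime? k n)

φ≡count : ∀ n → φ n ≡ count (coprimeTo n ∘ suc) n
φ≡count n = trans (length-filter-map-applyUpTo (λ k → gcd k n ≟ 1) suc (λ k → k) n)
  (count-cong n (λ k → does-⇔ (mk⇔ gcd≡1⇒coprime coprime⇒gcd≡1) (gcd (suc k) n ≟ 1) (coprime? (suc k) n)))

coprimeTo-periodic : ∀ n k → coprimeTo n (suc (n + k)) ≡ coprimeTo n (suc k)
coprimeTo-periodic n k = trans (cong (coprimeTo n) (sym (+-suc n k)))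
  (coprimeTo-cong {n + suc k} {suc k} {n} {n} coprime-+ˡ⇔)

φ-*-∣ : ∀ {m n} → m ∣ n → φ (m * n) ≡ m * φ n
φ-*-∣ {m} {n} m∣n = begin
  φ (m * n)                               ≡⟨ φ≡count (m * n) ⟩
  count (coprimeTo (m * n) ∘ suc) (m * n)
    ≡⟨ count-cong (m * n) (λ k → coprimeTo-cong {suc k} {suc k} {m * n} {n} (coprime-*-∣⇔ m∣n)) ⟩
  count (coprimeTo n ∘ suc) (m * n)       ≡⟨ count-periodic (coprimeTo n ∘ suc) n (coprimeTo-periodic n) m ⟩
  m * count (coprimeTo n ∘ suc) n         ≡⟨ cong (m *_) (sym (φ≡count n)) ⟩
  m * φ n                                 ∎
  where open ≡-Reasoning

-- Of the k ≤ p * n coprime to n, the multiples of p are the p * j with j ≤ n coprime to n,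
-- and the others are exactly those coprime to p * n.
φ-prime*-∤ : ∀ {p n} → Prime p → ¬ p ∣ n → φ n + φ (p * n) ≡ p * φ n
φ-prime*-∤ {p} {n} pp p∤n = sym (begin
  p * φ n                              ≡⟨ cong (p *_) (φ≡count n) ⟩
  p * count g n                        ≡⟨ count-periodic g n (coprimeTo-periodic n) p ⟨
  count g (p * n)                      ≡⟨ count-split g (λ k → does (p ∣? suc k)) (p * n) ⟩
  count (λ k → g k ∧ does (p ∣? suc k)) (p * n) + count (λ k → g k ∧ not (does (p ∣? suc k))) (p * n)
    ≡⟨ cong₂ _+_ (count-multiples (coprimeTo n) p {{prime⇒nonZero pp}} n) (count-cong (p * n) coprime-to-p*n) ⟩
  count (λ j → coprimeTo n (p * suc j)) n + count (coprimeTo (p * n) ∘ suc) (p * n)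
    ≡⟨ cong₂ _+_ (count-cong n (λ j → coprimeTo-cong {p * suc j} {suc j} {n} {n} (coprime-prime*ˡ⇔ pp p∤n)))
                 (sym (φ≡count (p * n))) ⟩
  count g n + φ (p * n)                ≡⟨ cong (_+ φ (p * n)) (φ≡count n) ⟨
  φ n + φ (p * n)                      ∎)
  where
  open ≡-Reasoning
  g : ℕ → Bool
  g = coprimeTo n ∘ suc
  coprime-to-p*n : ∀ k → g k ∧ not (does (p ∣? suc k)) ≡ coprimeTo (p * n) (suc k)
  coprime-to-p*n k =
    sym (does-⇔ (coprime-prime*⇔ pp) (coprime? (suc k) (p * n)) (coprime? (suc k) n ×-dec ¬? (p ∣? suc k)))

φ-p^[1+k]*m : ∀ {p m} → Prime p → ¬ p ∣ m → ∀ k → φ (p ^ suc k * m) ≡ p ^ k * (p ∸ 1) * φ m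
φ-p^[1+k]*m {p} {m} pp p∤m zero = begin
  φ (p * 1 * m)         ≡⟨ cong (λ x → φ (x * m)) (*-identityʳ p) ⟩
  φ (p * m)             ≡⟨ m+n∸m≡n (φ m) (φ (p * m)) ⟨
  φ m + φ (p * m) ∸ φ m ≡⟨ cong (_∸ φ m) (φ-prime*-∤ pp p∤m) ⟩
  p * φ m ∸ φ m         ≡⟨ cong (p * φ m ∸_) (*-identityˡ (φ m)) ⟨
  p * φ m ∸ 1 * φ m     ≡⟨ *-distribʳ-∸ (φ m) p 1 ⟨
  (p ∸ 1) * φ m         ≡⟨ cong (_* φ m) (*-identityˡ (p ∸ 1)) ⟨
  1 * (p ∸ 1) * φ m     ∎
  where open ≡-Reasoning
φ-p^[1+k]*m {p} {m} pp p∤m (suc k) = begin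
  φ (p * p ^ suc k * m)         ≡⟨ cong φ (*-assoc p (p ^ suc k) m) ⟩
  φ (p * (p ^ suc k * m))       ≡⟨ φ-*-∣ {p} {p ^ suc k * m} (∣m⇒∣m*n m (m∣m*n (p ^ k))) ⟩
  p * φ (p ^ suc k * m)         ≡⟨ cong (p *_) (φ-p^[1+k]*m pp p∤m k) ⟩
  p * (p ^ k * (p ∸ 1) * φ m)   ≡⟨ reassoc p (p ^ k) (p ∸ 1) (φ m) ⟩
  p * p ^ k * (p ∸ 1) * φ m     ∎
  where
  open ≡-Reasoning
  reassoc : ∀ a b c d → a * (b * c * d) ≡ a * b * c * d
  reassoc = solve-∀

φ-ratio-step : ∀ {p ps m} → Prime p → ¬ p ∣ m → ∀ k →
  product ps * φ m ≡ product (map (_∸ 1) ps) * m →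
  product (p ∷ ps) * φ (p ^ suc k * m) ≡ product (map (_∸ 1) (p ∷ ps)) * (p ^ suc k * m)
φ-ratio-step {p} {ps} {m} pp p∤m k ratio = begin
  p * P * φ (p ^ suc k * m)        ≡⟨ cong (p * P *_) (φ-p^[1+k]*m pp p∤m k) ⟩
  p * P * (p ^ k * (p ∸ 1) * φ m)  ≡⟨ regroup p P (p ^ k) (p ∸ 1) (φ m) ⟩
  (p ∸ 1) * p ^ suc k * (P * φ m)  ≡⟨ cong ((p ∸ 1) * p ^ suc k *_) ratio ⟩
  (p ∸ 1) * p ^ suc k * (Q * m)    ≡⟨ regroup′ (p ∸ 1) (p ^ suc k) Q m ⟩
  (p ∸ 1) * Q * (p ^ suc k * m)    ∎
  where
  open ≡-Reasoning
  P = product ps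
  Q = product (map (_∸ 1) ps)
  regroup : ∀ a b c d e → a * b * (c * d * e) ≡ d * (a * c) * (b * e)
  regroup = solve-∀
  regroup′ : ∀ a b c d → a * b * (c * d) ≡ a * c * (b * d)
  regroup′ = solve-∀

φ-product-formula : ∀ ps n .{{_ : NonZero n}} → Unique ps → (∀ {r} → r ∈ ps ⇔ (Prime r × r ∣ n)) →
  product ps * φ n ≡ product (map (_∸ 1) ps) * n
φ-product-formula [] n _ ∈ps⇔ = trans (cong (λ x → 1 * φ x) n≡1) (cong (1 *_) (sym n≡1))
  where
  n≡1 : n ≡ 1
  n≡1 = no-prime-divisor⇒≡1 n (λ pr r∣n → ∉[] (Equivalence.from ∈ps⇔ (pr , r∣n)))
φ-product-formula (p ∷ ps) n (p∉ps ∷ ps-unique) ∈ps⇔ with Equivalence.to ∈ps⇔ (here refl)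
... | pp , p∣n with p∣n⇒n≡p^[1+k]*m (prime⇒1< pp) n p∣n
...   | k , m , refl , p∤m =
  φ-ratio-step {ps = ps} pp p∤m k (φ-product-formula ps m {{m*n≢0⇒n≢0 (p ^ suc k)}} ps-unique ∈ps⇔m)
  where
  ∈ps⇔m : ∀ {r} → r ∈ ps ⇔ (Prime r × r ∣ m)
  ∈ps⇔m {r} = mk⇔ to from
    where
    to : r ∈ ps → Prime r × r ∣ m
    to r∈ps with Equivalence.to ∈ps⇔ (there r∈ps)
    ... | pr , r∣n = pr , prime∣m*n∧∤m⇒∣n pr r∤p^[1+k] r∣n
      where
      r∤p^[1+k] : ¬ r ∣ p ^ suc k
      r∤p^[1+k] = prime∤-^ pr (prime∤prime pr pp (≢-sym (All.lookup p∉ps r∈ps))) (suc k)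
    from : Prime r × r ∣ m → r ∈ ps
    from (pr , r∣m) with Equivalence.from ∈ps⇔ (pr , ∣n⇒∣m*n (p ^ suc k) r∣m)
    ... | here refl = contradiction r∣m p∤m
    ... | there r∈ps = r∈ps

∈W⇔ : ∀ {y r} .{{_ : NonZero y}} → r ∈ W y ⇔ (Prime r × r ∣ y)
∈W⇔ {y} {r} = mk⇔ (proj₂ ∘ ∈-filter⁻ prime-divisor? {xs = upTo (suc y)})
  (λ (pr , r∣y) → ∈-filter⁺ prime-divisor? (∈-upTo⁺ (s≤s (∣⇒≤ r∣y))) (pr , r∣y))
  where
  prime-divisor? : Decidable (λ p → Prime p × p ∣ y)
  prime-divisor? p = prime? p ×-dec (p ∣? y)

W-sorted : ∀ y → AllPairs _<_ (W y)
W-sorted y = AllPairsₚ.filter⁺ (λ p → prime? p ×-dec (p ∣? y))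
  (AllPairsₚ.applyUpTo⁺₁ (λ k → k) (suc y) (λ i<j _ → i<j))

φ-W-formula : ∀ y .{{_ : NonZero y}} → product (W y) * φ y ≡ product (map (_∸ 1) (W y)) * y
φ-W-formula y = φ-product-formula (W y) y (AllPairs.map <⇒≢ (W-sorted y)) ∈W⇔

sorted-primes∋2,3⇒2∷3∷p∷q : ∀ {xs} → length xs ≡ 4 → AllPairs _<_ xs → All Prime xs →
  2 ∈ xs → 3 ∈ xs →
  ∃₂ λ p q → xs ≡ 2 ∷ 3 ∷ p ∷ q ∷ [] × 3 < p × p < q
sorted-primes∋2,3⇒2∷3∷p∷q {a ∷ b ∷ c ∷ d ∷ []} refl
  ((a<b ∷ a<c ∷ a<d ∷ []) ∷ (b<c ∷ b<d ∷ []) ∷ (c<d ∷ []) ∷ [] ∷ []) (pa ∷ _) 2∈xs 3∈xs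
  with 2∈xs
... | there (here refl) = contradiction (prime⇒1< pa) (<⇒≱ a<b)
... | there (there (here refl)) = contradiction (prime⇒1< pa) (<⇒≱ a<c)
... | there (there (there (here refl))) = contradiction (prime⇒1< pa) (<⇒≱ a<d)
... | here refl with 3∈xs
...   | there (here refl) = c , d , refl , b<c , c<d
...   | there (there (here refl)) = contradiction a<b (<⇒≱ b<c)
...   | there (there (there (here refl))) = contradiction a<b (<⇒≱ b<d)

W≡2∷3∷p∷q⇒φ-ratio : ∀ {y p q} .{{_ : NonZero y}} → W y ≡ 2 ∷ 3 ∷ p ∷ q ∷ [] →
  6 * p * q * φ y ≡ 2 * (p ∸ 1) * (q ∸ 1) * y
W≡2∷3∷p∷q⇒φ-ratio {y} {p} {q} W≡ = begin
  6 * p * q * φ y                                ≡⟨ normalise p q (φ y) ⟩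
  product (2 ∷ 3 ∷ p ∷ q ∷ []) * φ y             ≡⟨ cong (λ ps → product ps * φ y) W≡ ⟨
  product (W y) * φ y                            ≡⟨ φ-W-formula y ⟩
  product (map (_∸ 1) (W y)) * y                 ≡⟨ cong (λ ps → product (map (_∸ 1) ps) * y) W≡ ⟩
  product (map (_∸ 1) (2 ∷ 3 ∷ p ∷ q ∷ [])) * y  ≡⟨ normalise′ (p ∸ 1) (q ∸ 1) y ⟩
  2 * (p ∸ 1) * (q ∸ 1) * y                      ∎
  where
  open ≡-Reasoning
  normalise : ∀ p q f → 6 * p * q * f ≡ 2 * (3 * (p * (q * 1))) * f
  normalise = solve-∀
  normalise′ : ∀ a b y → 1 * (2 * (a * (b * 1))) * y ≡ 2 * a * b * y
  normalise′ = solve-∀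

prime[3] : Prime 3
prime[3] = from-yes (prime? 3)

prime[5] : Prime 5
prime[5] = from-yes (prime? 5)

φ-R[0] : ∀ k → φ (R 0 (suc k)) ≡ 5 ^ k * 4
φ-R[0] k = begin
  φ (2 * 5 ^ suc k)  ≡⟨ cong φ (*-comm 2 (5 ^ suc k)) ⟩
  φ (5 ^ suc k * 2)  ≡⟨ φ-p^[1+k]*m prime[5] (from-no (5 ∣? 2)) k ⟩
  5 ^ k * 4 * 1      ≡⟨ *-identityʳ (5 ^ k * 4) ⟩
  5 ^ k * 4          ∎
  where open ≡-Reasoning

φ-R[1+j] : ∀ j k → φ (R (suc j) (suc k)) ≡ 5 ^ k * 4 * (3 ^ j * 2)
φ-R[1+j] j k = begin
  φ (2 * 3 ^ suc j * 5 ^ suc k)         ≡⟨ cong φ (reorder 2 (3 ^ suc j) (5 ^ suc k)) ⟩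
  φ (5 ^ suc k * (3 ^ suc j * 2))       ≡⟨ φ-p^[1+k]*m prime[5] 5∤3^[1+j]*2 k ⟩
  5 ^ k * 4 * φ (3 ^ suc j * 2)         ≡⟨ cong (5 ^ k * 4 *_) (φ-p^[1+k]*m prime[3] (from-no (3 ∣? 2)) j) ⟩
  5 ^ k * 4 * (3 ^ j * 2 * 1)           ≡⟨ cong (5 ^ k * 4 *_) (*-identityʳ (3 ^ j * 2)) ⟩
  5 ^ k * 4 * (3 ^ j * 2)               ∎
  where
  open ≡-Reasoning
  reorder : ∀ a b c → a * b * c ≡ c * (b * a)
  reorder = solve-∀
  5∤3^[1+j]*2 : ¬ 5 ∣ 3 ^ suc j * 2
  5∤3^[1+j]*2 = prime∤-* prime[5] (prime∤-^ prime[5] (from-no (5 ∣? 3)) (suc j)) (from-no (5 ∣? 2))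

φ≢φ-R[0] : ∀ {y p q} k → ¬ 2 ∣ p → ¬ 2 ∣ q → 2 ∣ y →
  6 * p * q * φ y ≡ 2 * (p ∸ 1) * (q ∸ 1) * y → φ y ≢ φ (R 0 (suc k))
φ≢φ-R[0] {y} {p} {q} k 2∤p 2∤q 2∣y ratio φy≡φR = 2∤3pq5^k (*-cancelˡ-∣ 8 8*2∣8*[3pq5^k])
  where
  16∣rhs : 2 * 2 * 2 * 2 ∣ 2 * (p ∸ 1) * (q ∸ 1) * y
  16∣rhs = *-pres-∣ (*-pres-∣ (*-pres-∣ (∣-refl {2}) (2∤n⇒2∣n∸1 2∤p)) (2∤n⇒2∣n∸1 2∤q)) 2∣y
  lhs≡ : 6 * p * q * φ y ≡ 8 * (3 * p * q * 5 ^ k)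
  lhs≡ = trans (cong (6 * p * q *_) (trans φy≡φR (φ-R[0] k))) (regroup p q (5 ^ k))
    where
    regroup : ∀ p q x → 6 * p * q * (x * 4) ≡ 8 * (3 * p * q * x)
    regroup = solve-∀
  8*2∣8*[3pq5^k] : 8 * 2 ∣ 8 * (3 * p * q * 5 ^ k)
  8*2∣8*[3pq5^k] = subst (16 ∣_) (trans (sym ratio) lhs≡) 16∣rhs
  2∤3pq5^k : ¬ 2 ∣ 3 * p * q * 5 ^ k
  2∤3pq5^k = prime∤-* prime[2] (prime∤-* prime[2] (prime∤-* prime[2] (from-no (2 ∣? 3)) 2∤p) 2∤q)
               (prime∤-^ prime[2] (from-no (2 ∣? 5)) k)

prime>3∧≢5⇒≡7⊎≥11 : ∀ {p} → Prime p → 3 < p → p ≢ 5 → p ≡ 7 ⊎ 11 ≤ p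
prime>3∧≢5⇒≡7⊎≥11 {2} _ (s≤s (s≤s ())) _
prime>3∧≢5⇒≡7⊎≥11 {3} _ (s≤s (s≤s (s≤s ()))) _
prime>3∧≢5⇒≡7⊎≥11 {4} pp _ _ = contradiction pp (from-no (prime? 4))
prime>3∧≢5⇒≡7⊎≥11 {5} _ _ p≢5 = contradiction refl p≢5
prime>3∧≢5⇒≡7⊎≥11 {6} pp _ _ = contradiction pp (from-no (prime? 6))
prime>3∧≢5⇒≡7⊎≥11 {7} _ _ _ = inj₁ refl
prime>3∧≢5⇒≡7⊎≥11 {8} pp _ _ = contradiction pp (from-no (prime? 8))
prime>3∧≢5⇒≡7⊎≥11 {9} pp _ _ = contradiction pp (from-no (prime? 9))
prime>3∧≢5⇒≡7⊎≥11 {10} pp _ _ = contradiction pp (from-no (prime? 10))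
prime>3∧≢5⇒≡7⊎≥11 {suc (suc (suc (suc (suc (suc (suc (suc (suc (suc (suc p))))))))))} _ _ _ = inj₂ (m≤m+n 11 p)

4[1+P][1+Q]≤5PQ : ∀ {P Q} → (P ≡ 6 × 25 ≤ Q) ⊎ (10 ≤ P × 11 ≤ Q) → 4 * suc P * suc Q ≤ 5 * P * Q
4[1+P][1+Q]≤5PQ {Q = Q} (inj₁ (refl , 25≤Q)) =
  subst (λ Q → 4 * 7 * suc Q ≤ 5 * 6 * Q) (m+[n∸m]≡n 25≤Q) (p≡7-bound (Q ∸ 25))
  where
  p≡7-bound : ∀ t → 4 * 7 * suc (25 + t) ≤ 5 * 6 * (25 + t)
  p≡7-bound t = subst (4 * 7 * suc (25 + t) ≤_) (expand t) (m≤m+n (4 * 7 * suc (25 + t)) (22 + 2 * t))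
    where
    expand : ∀ t → 4 * 7 * suc (25 + t) + (22 + 2 * t) ≡ 5 * 6 * (25 + t)
    expand = solve-∀
4[1+P][1+Q]≤5PQ {P} {Q} (inj₂ (10≤P , 11≤Q)) =
  subst₂ (λ P Q → 4 * suc P * suc Q ≤ 5 * P * Q) (m+[n∸m]≡n 10≤P) (m+[n∸m]≡n 11≤Q)
    (p≥11-bound (P ∸ 10) (Q ∸ 11))
  where
  p≥11-bound : ∀ s t → 4 * suc (10 + s) * suc (11 + t) ≤ 5 * (10 + s) * (11 + t)
  p≥11-bound s t = subst (4 * suc (10 + s) * suc (11 + t) ≤_) (expand s t)
    (m≤m+n (4 * suc (10 + s) * suc (11 + t)) (22 + 7 * s + 6 * t + s * t))
    where
    expand : ∀ s t → 4 * suc (10 + s) * suc (11 + t) + (22 + 7 * s + 6 * t + s * t) ≡ 5 * (10 + s) * (11 + t)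
    expand = solve-∀

≤-from-φ-ratios : ∀ {y R f p q a b} .{{_ : NonZero (a * b)}} →
  6 * p * q * f ≡ 2 * a * b * y → 4 * R ≡ 15 * f → 4 * p * q ≤ 5 * a * b → y ≤ R
≤-from-φ-ratios {y} {R} {f} {p} {q} {a} {b} y-ratio R-ratio 4pq≤5ab =
  *-cancelˡ-≤ (8 * (a * b)) {{m*n≢0 8 (a * b)}} (begin
    8 * (a * b) * y        ≡⟨ regroupʸ a b y ⟩
    4 * (2 * a * b * y)    ≡⟨ cong (4 *_) y-ratio ⟨
    4 * (6 * p * q * f)    ≡⟨ regroupᶠ p q f ⟩
    6 * f * (4 * p * q)    ≤⟨ *-monoʳ-≤ (6 * f) 4pq≤5ab ⟩
    6 * f * (5 * a * b)    ≡⟨ regroupᶠ′ a b f ⟩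
    2 * (a * b) * (15 * f) ≡⟨ cong (2 * (a * b) *_) R-ratio ⟨
    2 * (a * b) * (4 * R)  ≡⟨ regroupᴿ a b R ⟩
    8 * (a * b) * R        ∎)
  where
  open ≤-Reasoning
  regroupʸ : ∀ a b y → 8 * (a * b) * y ≡ 4 * (2 * a * b * y)
  regroupʸ = solve-∀
  regroupᶠ : ∀ p q f → 4 * (6 * p * q * f) ≡ 6 * f * (4 * p * q)
  regroupᶠ = solve-∀
  regroupᶠ′ : ∀ a b f → 6 * f * (5 * a * b) ≡ 2 * (a * b) * (15 * f)
  regroupᶠ′ = solve-∀
  regroupᴿ : ∀ a b R → 2 * (a * b) * (4 * R) ≡ 8 * (a * b) * R
  regroupᴿ = solve-∀

y≤R[1+j] : ∀ {y p q} j k → Prime p → Prime q → 3 < p → p < q → p ≢ 5 → ¬ 5 ∣ y →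
  6 * p * q * φ y ≡ 2 * (p ∸ 1) * (q ∸ 1) * y → φ y ≡ φ (R (suc j) (3 + k)) → y ≤ R (suc j) (3 + k)
y≤R[1+j] {p = zero} _ _ _ _ () _ _ _ _ _
y≤R[1+j] {p = suc _} {zero} _ _ _ _ _ () _ _ _ _
y≤R[1+j] {y} {suc P} {suc Q} j k pp pq 3<p p<q p≢5 5∤y y-ratio φy≡φR =
  ≤-from-φ-ratios {y} {R (suc j) (3 + k)} {φ y} {suc P} {suc Q} {P} {Q}
    {{m*n≢0 P Q {{>-nonZero 0<P}} {{>-nonZero 0<Q}}}} y-ratio R-ratio (4[1+P][1+Q]≤5PQ P,Q-range)
  where
  0<P : 0 < P
  0<P = ≤-trans (s≤s z≤n) (s≤s⁻¹ 3<p)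
  0<Q : 0 < Q
  0<Q = ≤-trans (s≤s z≤n) (s≤s⁻¹ p<q)
  φy≡ : φ y ≡ 5 ^ (2 + k) * 4 * (3 ^ j * 2)
  φy≡ = trans φy≡φR (φ-R[1+j] j (2 + k))
  R-ratio : 4 * R (suc j) (3 + k) ≡ 15 * φ y
  R-ratio = trans (regroup (3 ^ j) (5 ^ (2 + k))) (cong (15 *_) (sym φy≡))
    where
    regroup : ∀ x z → 4 * (2 * (3 * x) * (5 * z)) ≡ 15 * (z * 4 * (x * 2))
    regroup = solve-∀
  25∣φy : 5 ^ 2 ∣ φ y
  25∣φy = subst (5 ^ 2 ∣_) (sym φy≡)
    (∣m⇒∣m*n _ (∣m⇒∣m*n 4 (subst (5 ^ 2 ∣_) (sym (^-distribˡ-+-* 5 2 k)) (m∣m*n (5 ^ k)))))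
  25≤Q : P ≡ 6 → 25 ≤ Q
  25≤Q P≡6 = ∣⇒≤ {{>-nonZero 0<Q}} (prime^∣m*n∧∤m⇒∣n prime[5] 5∤2Py 2
    (subst (5 ^ 2 ∣_) (trans y-ratio (regroup P Q y)) (∣n⇒∣m*n (6 * suc P * suc Q) 25∣φy)))
    where
    5∤2Py : ¬ 5 ∣ 2 * P * y
    5∤2Py = prime∤-* prime[5]
      (prime∤-* prime[5] (from-no (5 ∣? 2)) (subst (λ n → ¬ 5 ∣ n) (sym P≡6) (from-no (5 ∣? 6)))) 5∤y
    regroup : ∀ P Q y → 2 * P * Q * y ≡ 2 * P * y * Q
    regroup = solve-∀
  P,Q-range : (P ≡ 6 × 25 ≤ Q) ⊎ (10 ≤ P × 11 ≤ Q)
  P,Q-range with prime>3∧≢5⇒≡7⊎≥11 pp 3<p p≢5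
  ... | inj₁ p≡7 = inj₁ (suc-injective p≡7 , 25≤Q (suc-injective p≡7))
  ... | inj₂ 11≤p = inj₂ (s≤s⁻¹ 11≤p , s≤s⁻¹ (≤-trans (s≤s 11≤p) p<q))

lemma3p12 : (r₁ r₂ y : ℕ) → 2 < r₂ →
    φ y ≡ φ (R r₁ r₂) →
    ∣W∣ y ≡ 4 →
    2 ∣ y → ¬ (2 ^ 2 ∣ y) →
    3 ∣ y →
    ¬ (5 ∣ y) →
    y ≤ R r₁ r₂
lemma3p12 r₁ r₂ zero _ _ () _ _ _ _
lemma3p12 r₁ r₂ y@(suc _) 2<r₂ φy≡φR ∣W∣≡4 2∣y _ 3∣y 5∤y
  with sorted-primes∋2,3⇒2∷3∷p∷q ∣W∣≡4 (W-sorted y) (All.tabulate (proj₁ ∘ Equivalence.to (∈W⇔ {y})))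
         (Equivalence.from ∈W⇔ (prime[2] , 2∣y)) (Equivalence.from ∈W⇔ (prime[3] , 3∣y))
... | p , q , W≡ , 3<p , p<q =
  subst (λ r₂ → φ y ≡ φ (R r₁ r₂) → y ≤ R r₁ r₂) (m+[n∸m]≡n 2<r₂) (bound r₁) φy≡φR
  where
  k = r₂ ∸ 3
  p∈W : Prime p × p ∣ y
  p∈W = Equivalence.to ∈W⇔ (subst (p ∈_) (sym W≡) (there (there (here refl))))
  q∈W : Prime q × q ∣ y
  q∈W = Equivalence.to ∈W⇔ (subst (q ∈_) (sym W≡) (there (there (there (here refl)))))
  2<p : 2 < p
  2<p = <-trans (n<1+n 2) 3<p
  2∤ : ∀ {r} → Prime r → 2 < r → ¬ 2 ∣ r
  2∤ pr 2<r = prime∤prime prime[2] pr (<⇒≢ 2<r)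
  bound : ∀ r₁ → φ y ≡ φ (R r₁ (3 + k)) → y ≤ R r₁ (3 + k)
  bound zero φy≡φR = contradiction φy≡φR
    (φ≢φ-R[0] (2 + k) (2∤ (proj₁ p∈W) 2<p) (2∤ (proj₁ q∈W) (<-trans 2<p p<q)) 2∣y
      (W≡2∷3∷p∷q⇒φ-ratio W≡))
  bound (suc j) φy≡φR = y≤R[1+j] j k (proj₁ p∈W) (proj₁ q∈W) 3<p p<q
    (λ p≡5 → 5∤y (subst (_∣ y) p≡5 (proj₂ p∈W))) 5∤y (W≡2∷3∷p∷q⇒φ-ratio W≡) φy≡φR
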